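{- For every integer $k\geq 3$ there exists a 2-track interval graph $G$ on $2k$ vertices with maximum degree $\Delta(G)=2k-2$ such that \textsc{Greedy} can return (for some tie-breaking) an independent set of size $2$, while a maximum independent set of $G$ has size $k$.
   Context: Graphs are finite, simple, undirected. An interval graph is a graph whose vertices can be represented by closed real intervals so that two vertices are adjacent iff their intervals intersect. A 2-track interval graph is a graph $G=(V,E_1\cup E_2)$ such that $(V,E_1)$ and $(V,E_2)$ are both interval graphs. \textsc{Greedy} is the minimum-degree greedy algorithm: start with $S=\emptyset$; while the current graph is nonempty, choose any vertex of minimum degree in the current graph (ties broken arbitrarily/adversarially), add it to $S$ and delete it together with all its neighbours. -}

module Defs where

open import Data.Nat using (ℕ; _≤_)
open import Data.Bool using (Bool; true; false; _∨_)
open import Data.Fin using (Fin)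
open import Data.Fin.Subset using (Subset; ⁅_⁆; _∈_; _∪_; _∩_; _─_; ∣_∣; ⊤; Empty)
open import Data.Vec using (tabulate)
open import Data.Product using (Σ; ∃; _×_; _,_)
open import Function.Bundles using (_⇔_)
open import Relation.Binary.PropositionalEquality using (_≡_; _≢_)

record Graph (n : ℕ) : Set where
  field
    adj    : Fin n → Fin n → Bool
    sym    : ∀ i j → adj i j ≡ adj j i
    irrefl : ∀ i → adj i i ≡ false
open Graph public

IntervalsIntersect : ℕ → ℕ → ℕ → ℕ → Set
IntervalsIntersect a b c d = (a ≤ d) × (c ≤ b)

IsIntervalGraph : ∀ {n} → Graph n → Set
IsIntervalGraph {n} G =
  Σ (Fin n → ℕ) λ l → Σ (Fin n → ℕ) λ r →
    (∀ i → l i ≤ r i) ×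
    (∀ i j → i ≢ j → (adj G i j ≡ true) ⇔ IntervalsIntersect (l i) (r i) (l j) (r j))

Is2TrackIntervalGraph : ∀ {n} → Graph n → Set
Is2TrackIntervalGraph {n} G =
  Σ (Graph n) λ G₁ → Σ (Graph n) λ G₂ →
    IsIntervalGraph G₁ × IsIntervalGraph G₂ ×
    (∀ i j → adj G i j ≡ (adj G₁ i j ∨ adj G₂ i j))

nbhd : ∀ {n} → Graph n → Fin n → Subset n
nbhd G v = tabulate (adj G v)

degIn : ∀ {n} → Graph n → Subset n → Fin n → ℕ
degIn G A v = ∣ A ∩ nbhd G v ∣

degree : ∀ {n} → Graph n → Fin n → ℕ
degree G v = degIn G ⊤ v

MaxDegree : ∀ {n} → Graph n → ℕ → Set
MaxDegree G d = (∀ v → degree G v ≤ d) × ∃ λ v → degree G v ≡ d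

IsIndependent : ∀ {n} → Graph n → Subset n → Set
IsIndependent G S = ∀ i j → i ∈ S → j ∈ S → adj G i j ≡ false

IndependenceNumber : ∀ {n} → Graph n → ℕ → Set
IndependenceNumber G a =
  (∃ λ S → IsIndependent G S × ∣ S ∣ ≡ a) ×
  (∀ S → IsIndependent G S → ∣ S ∣ ≤ a)

-- GreedyRun G A S : starting from the current graph G[A], some run of the
-- minimum-degree greedy algorithm (with some tie-breaking) returns S.
data GreedyRun {n} (G : Graph n) : Subset n → Subset n → Set where
  done : ∀ {A} → Empty A → GreedyRun G A (Data.Fin.Subset.⊥)
  step : ∀ {A S} (v : Fin n) → v ∈ A →
         (∀ u → u ∈ A → degIn G A v ≤ degIn G A u) →
         GreedyRun G (A ─ (⁅ v ⁆ ∪ nbhd G v)) S →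
         GreedyRun G A (⁅ v ⁆ ∪ S)

GreedyCanReturn : ∀ {n} → Graph n → Subset n → Set
GreedyCanReturn G S = GreedyRun G ⊤ S

{-# OPTIONS --safe #-}
-- Every vertex of G has one of four kinds: an apex and k − 1 core vertices form a clique of
-- size k, each of the k − 1 pairwise non-adjacent leaves is joined to every core vertex, and a
-- centre is joined to every leaf.  Adjacency of distinct vertices depends only on their kinds, so
-- degrees, and the sets Greedy leaves behind, are computed kind by kind.  Track 1 carries the
-- clique and the leaf–core edges (leaves are points inside the long core intervals), track 2 the
-- star at the centre.  The centre and the apex have the minimum degree k − 1, so Greedy may take
-- the centre, which deletes every leaf; what remains is the clique, from which it takes the apex
-- and stops.  Yet the leaves together with the apex are independent, and no independent set is
-- larger: it meets the clique at most once, and cannot contain the centre and a leaf together.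

module Submission where

open import Defs hiding (sym)
open import Data.Bool using (Bool; true; false; not; _∧_; _∨_; if_then_else_)
open import Data.Bool.Properties using (∧-zeroʳ; ∧-identityʳ; ∧-distribˡ-∨; ∨-comm)
open import Data.Fin using (Fin; zero; suc; toℕ; _≟_; _↑ʳ_)
open import Data.Fin.Properties using (toℕ-injective; toℕ<n; 0≢1+n) renaming (suc-injective to suc-injectiveᶠ)
open import Data.Fin.Subset
  using (Subset; inside; outside; ⁅_⁆; _∈_; _∉_; _⊆_; _⊂_; _∪_; _∩_; _─_; _-_; ∣_∣; ⊤; ⊥; Empty)
open import Data.Fin.Subset.Properties
  using (p─⊥≡p; ∪-identityˡ; ∣⊤∣≡n; ∣⊥∣≡0; Empty-unique; ∉⊥; x∈p∩q⁻; x∈p∪q⁻; _∈?_; p─q⊆p;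
         p⊂q⇒∣p∣<∣q∣; x∈⁅y⁆⇒x≡y)
open import Data.Nat using (ℕ; zero; suc; _+_; _*_; _∸_; _≤_; _<_; z≤n; s≤s)
open import Data.Nat.Properties
  using (+-identityʳ; +-suc; +-comm; +-cancelˡ-≡; +-mono-≤; suc-injective; ≤-refl; ≤-reflexive; ≤-trans; ≤-antisym;
         <⇒≤; <⇒≱; m≤m+n; m≤n+m; n≤1+n; module ≤-Reasoning)
open import Data.Product using (Σ; ∃; _×_; _,_; proj₁; proj₂)
open import Data.Sum using (inj₁; inj₂)
open import Data.Vec using (Vec; []; _∷_; _++_; lookup; replicate; tabulate; map; here; there)
open import Data.Vec.Properties
  using (lookup∘tabulate; tabulate∘lookup; tabulate-cong; tabulate-∘; lookup-zipWith; lookup-replicate; lookup-++ʳ;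
         map-++; map-replicate; []=⇒lookup; lookup⇒[]=)
open import Function using (_∘_; _⇔_; mk⇔)
open import Relation.Binary.PropositionalEquality
open import Relation.Nullary using (¬_; Dec; does; yes; no; contradiction)
open import Relation.Nullary.Decidable using (dec-true; dec-false)

private
  variable
    n : ℕ
    p q : Subset n
    x y : Fin n

lookup-ext : {p q : Vec Bool n} → (∀ i → lookup p i ≡ lookup q i) → p ≡ q
lookup-ext {p = p} {q} eq = begin
  p                  ≡⟨ tabulate∘lookup p ⟨
  tabulate (lookup p) ≡⟨ tabulate-cong eq ⟩
  tabulate (lookup q) ≡⟨ tabulate∘lookup q ⟩
  q                  ∎
  where open ≡-Reasoning

lookup-─ : ∀ (p q : Subset n) i → lookup (p ─ q) i ≡ lookup p i ∧ not (lookup q i)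
lookup-─ (s ∷ p) (inside  ∷ q) zero    = sym (∧-zeroʳ s)
lookup-─ (s ∷ p) (outside ∷ q) zero    = sym (∧-identityʳ s)
lookup-─ (s ∷ p) (t       ∷ q) (suc i) = lookup-─ p q i

lookup-⁅⁆ : ∀ (x i : Fin n) → lookup ⁅ x ⁆ i ≡ does (x ≟ i)
lookup-⁅⁆ zero    zero    = refl
lookup-⁅⁆ zero    (suc i) = lookup-replicate i outside
lookup-⁅⁆ (suc x) zero    = refl
lookup-⁅⁆ (suc x) (suc i) = lookup-⁅⁆ x i

∣p++q∣ : ∀ {m} (p : Subset m) (q : Subset n) → ∣ p ++ q ∣ ≡ ∣ p ∣ + ∣ q ∣
∣p++q∣ []            q = refl
∣p++q∣ (inside  ∷ p) q = cong suc (∣p++q∣ p q)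
∣p++q∣ (outside ∷ p) q = ∣p++q∣ p q

∣replicate∣ : ∀ n t → ∣ replicate n t ∣ ≡ (if t then n else 0)
∣replicate∣ n inside  = ∣⊤∣≡n n
∣replicate∣ n outside = ∣⊥∣≡0 n

∣x∷replicate∣ : ∀ n s t → ∣ s ∷ replicate n t ∣ ≡ (if s then 1 else 0) + (if t then n else 0)
∣x∷replicate∣ n inside  t = cong suc (∣replicate∣ n t)
∣x∷replicate∣ n outside t = ∣replicate∣ n t

∣p∣≡∣p∩q∣+∣p─q∣ : ∀ (p q : Subset n) → ∣ p ∣ ≡ ∣ p ∩ q ∣ + ∣ p ─ q ∣
∣p∣≡∣p∩q∣+∣p─q∣ []            []            = refl
∣p∣≡∣p∩q∣+∣p─q∣ (inside  ∷ p) (inside  ∷ q) = cong suc (∣p∣≡∣p∩q∣+∣p─q∣ p q)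
∣p∣≡∣p∩q∣+∣p─q∣ (inside  ∷ p) (outside ∷ q) =
  trans (cong suc (∣p∣≡∣p∩q∣+∣p─q∣ p q)) (sym (+-suc _ _))
∣p∣≡∣p∩q∣+∣p─q∣ (outside ∷ p) (inside  ∷ q) = ∣p∣≡∣p∩q∣+∣p─q∣ p q
∣p∣≡∣p∩q∣+∣p─q∣ (outside ∷ p) (outside ∷ q) = ∣p∣≡∣p∩q∣+∣p─q∣ p q

x∈p⇒suc∣p-x∣≡∣p∣ : x ∈ p → suc ∣ p - x ∣ ≡ ∣ p ∣
x∈p⇒suc∣p-x∣≡∣p∣ {p = inside  ∷ p} here        = cong (suc ∘ ∣_∣) (p─⊥≡p p)
x∈p⇒suc∣p-x∣≡∣p∣ {p = inside  ∷ p} (there x∈p) = cong suc (x∈p⇒suc∣p-x∣≡∣p∣ x∈p)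
x∈p⇒suc∣p-x∣≡∣p∣ {p = outside ∷ p} (there x∈p) = x∈p⇒suc∣p-x∣≡∣p∣ x∈p

x∉p⇒p-x≡p : x ∉ p → p - x ≡ p
x∉p⇒p-x≡p {x = zero}  {p = inside  ∷ p} x∉p = contradiction here x∉p
x∉p⇒p-x≡p {x = zero}  {p = outside ∷ p} x∉p = cong (outside ∷_) (p─⊥≡p p)
x∉p⇒p-x≡p {x = suc x} {p = s ∷ p}       x∉p = cong (s ∷_) (x∉p⇒p-x≡p (x∉p ∘ there))

x∉p⇒∣⁅x⁆∪p∣≡suc∣p∣ : x ∉ p → ∣ ⁅ x ⁆ ∪ p ∣ ≡ suc ∣ p ∣
x∉p⇒∣⁅x⁆∪p∣≡suc∣p∣ {x = zero}  {p = inside  ∷ p} x∉p = contradiction here x∉p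
x∉p⇒∣⁅x⁆∪p∣≡suc∣p∣ {x = zero}  {p = outside ∷ p} x∉p = cong (suc ∘ ∣_∣) (∪-identityˡ p)
x∉p⇒∣⁅x⁆∪p∣≡suc∣p∣ {x = suc x} {p = inside  ∷ p} x∉p =
  cong suc (x∉p⇒∣⁅x⁆∪p∣≡suc∣p∣ (x∉p ∘ there))
x∉p⇒∣⁅x⁆∪p∣≡suc∣p∣ {x = suc x} {p = outside ∷ p} x∉p = x∉p⇒∣⁅x⁆∪p∣≡suc∣p∣ (x∉p ∘ there)

x∈p─q⇒x∉q : ∀ (p q : Subset n) → x ∈ p ─ q → x ∉ q
x∈p─q⇒x∉q (inside ∷ p) (outside ∷ q) here          = λ ()
x∈p─q⇒x∉q (s      ∷ p) (t       ∷ q) (there x∈p─q) (there x∈q) = x∈p─q⇒x∉q p q x∈p─q x∈q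

subsingleton⇒∣p∣≤1 : ∀ {n} {p : Subset n} → (∀ {x y} → x ∈ p → y ∈ p → x ≡ y) → ∣ p ∣ ≤ 1
subsingleton⇒∣p∣≤1 {p = []}          _        = z≤n
subsingleton⇒∣p∣≤1 {p = outside ∷ p} all-same =
  subsingleton⇒∣p∣≤1 (λ x∈p y∈p → suc-injectiveᶠ (all-same (there x∈p) (there y∈p)))
subsingleton⇒∣p∣≤1 {n = suc n} {p = inside ∷ p} all-same =
  s≤s (≤-reflexive (trans (cong ∣_∣ (Empty-unique p-empty)) (∣⊥∣≡0 n)))
  where
  p-empty : Empty p
  p-empty (y , y∈p) = 0≢1+n (all-same here (there y∈p))

-- Independent sets and cliques

IsClique : Graph n → Subset n → Set
IsClique G K = ∀ i j → i ∈ K → j ∈ K → i ≢ j → adj G i j ≡ true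

module _ (G : Graph n) where

  independent-⊆ : ∀ {S T} → T ⊆ S → IsIndependent G S → IsIndependent G T
  independent-⊆ T⊆S indS i j i∈T j∈T = indS i j (T⊆S i∈T) (T⊆S j∈T)

  independent-⁅⁆∪ : ∀ {S} v → IsIndependent G S → (∀ u → u ∈ S → adj G v u ≡ false) →
                    IsIndependent G (⁅ v ⁆ ∪ S)
  independent-⁅⁆∪ {S} v indS v≁S i j i∈ j∈ with x∈p∪q⁻ ⁅ v ⁆ S i∈ | x∈p∪q⁻ ⁅ v ⁆ S j∈
  ... | inj₁ i∈v | inj₁ j∈v rewrite x∈⁅y⁆⇒x≡y v i∈v | x∈⁅y⁆⇒x≡y v j∈v = irrefl G v
  ... | inj₁ i∈v | inj₂ j∈S rewrite x∈⁅y⁆⇒x≡y v i∈v = v≁S j j∈S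
  ... | inj₂ i∈S | inj₁ j∈v rewrite x∈⁅y⁆⇒x≡y v j∈v = trans (Graph.sym G i v) (v≁S i i∈S)
  ... | inj₂ i∈S | inj₂ j∈S = indS i j i∈S j∈S

  ∣independent∩clique∣≤1 : ∀ {S K} → IsIndependent G S → IsClique G K → ∣ S ∩ K ∣ ≤ 1
  ∣independent∩clique∣≤1 {S} {K} indS cliqueK = subsingleton⇒∣p∣≤1 same
    where
    same : ∀ {i j} → i ∈ S ∩ K → j ∈ S ∩ K → i ≡ j
    same {i} {j} i∈ j∈ with i ≟ j | x∈p∩q⁻ S K i∈ | x∈p∩q⁻ S K j∈
    ... | yes i≡j | _ | _ = i≡j
    ... | no i≢j | i∈S , i∈K | j∈S , j∈K =
      contradiction (trans (sym (cliqueK i j i∈K j∈K i≢j)) (indS i j i∈S j∈S)) λ ()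

  independent-⊂ : ∀ {S L i j} → IsIndependent G S → S ⊆ L → i ∈ L → j ∈ L → adj G i j ≡ true → S ⊂ L
  independent-⊂ {S} {i = i} {j} indS S⊆L i∈L j∈L i∼j with j ∈? S
  ... | no  j∉S = S⊆L , j , j∈L , j∉S
  ... | yes j∈S = S⊆L , i , i∈L , λ i∈S → contradiction (trans (sym i∼j) (indS i j i∈S j∈S)) λ ()

  independent-bound : ∀ {S K L i j} → IsIndependent G S → IsClique G K → S ─ K ⊆ L →
                      i ∈ L → j ∈ L → adj G i j ≡ true → ∣ S ∣ ≤ ∣ L ∣
  independent-bound {S} {K} {L} indS cliqueK S─K⊆L i∈L j∈L i∼j = begin
    ∣ S ∣                 ≡⟨ ∣p∣≡∣p∩q∣+∣p─q∣ S K ⟩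
    ∣ S ∩ K ∣ + ∣ S ─ K ∣ ≤⟨ +-mono-≤ (∣independent∩clique∣≤1 indS cliqueK) ≤-refl ⟩
    suc ∣ S ─ K ∣         ≤⟨ p⊂q⇒∣p∣<∣q∣ S─K⊂L ⟩
    ∣ L ∣                 ∎
    where
    open ≤-Reasoning
    S─K⊂L : S ─ K ⊂ L
    S─K⊂L = independent-⊂ (independent-⊆ (p─q⊆p S K) indS) S─K⊆L i∈L j∈L i∼j

-- Graphs in which adjacency depends only on the kinds of the vertices

does-≟-sym : ∀ (i j : Fin n) → does (i ≟ j) ≡ does (j ≟ i)
does-≟-sym i j with i ≟ j
... | yes refl = sym (dec-true (i ≟ i) refl)
... | no  i≢j  = sym (dec-false (j ≟ i) (i≢j ∘ sym))

symmetrise : ∀ {T : Set} → (T → T → Bool) → T → T → Bool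
symmetrise E s t = E s t ∨ E t s

symmetrise-sym : ∀ {T : Set} (E : T → T → Bool) s t → symmetrise E s t ≡ symmetrise E t s
symmetrise-sym E s t = ∨-comm (E s t) (E t s)

module BlowUp {T : Set} (kind : Fin n → T) (H : T → T → Bool) (H-sym : ∀ s t → H s t ≡ H t s) where

  graph : Graph n
  graph = record
    { adj    = λ i j → not (does (i ≟ j)) ∧ H (kind i) (kind j)
    ; sym    = λ i j → cong₂ (λ b c → not b ∧ c) (does-≟-sym i j) (H-sym (kind i) (kind j))
    ; irrefl = λ i → cong (λ b → not b ∧ H (kind i) (kind i)) (dec-true (i ≟ i) refl)
    }

  adj-≢ : ∀ {i j} → i ≢ j → adj graph i j ≡ H (kind i) (kind j)
  adj-≢ {i} {j} i≢j = cong (λ b → not b ∧ H (kind i) (kind j)) (dec-false (i ≟ j) i≢j)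

  ⟦_⟧ : (T → Bool) → Subset n
  ⟦ a ⟧ = tabulate (a ∘ kind)

  ∈⟦⟧⁺ : ∀ {a v} → a (kind v) ≡ true → v ∈ ⟦ a ⟧
  ∈⟦⟧⁺ {a} {v} av = lookup⇒[]= v ⟦ a ⟧ (trans (lookup∘tabulate (a ∘ kind) v) av)

  ∈⟦⟧⁻ : ∀ {a v} → v ∈ ⟦ a ⟧ → a (kind v) ≡ true
  ∈⟦⟧⁻ {a} {v} v∈ = trans (sym (lookup∘tabulate (a ∘ kind) v)) ([]=⇒lookup v∈)

  ∉⟦⟧⁺ : ∀ {a v} → a (kind v) ≡ false → v ∉ ⟦ a ⟧
  ∉⟦⟧⁺ {a} av v∈ = contradiction (trans (sym av) (∈⟦⟧⁻ {a} v∈)) λ ()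

  p─⟦a⟧⊆⟦not∘a⟧ : ∀ p a → p ─ ⟦ a ⟧ ⊆ ⟦ not ∘ a ⟧
  p─⟦a⟧⊆⟦not∘a⟧ p a {v} v∈ with a (kind v) in av
  ... | true  = contradiction (∈⟦⟧⁺ {a} av) (x∈p─q⇒x∉q p ⟦ a ⟧ v∈)
  ... | false = ∈⟦⟧⁺ {not ∘ a} (cong not av)

  ⊤≡⟦true⟧ : ⊤ ≡ ⟦ (λ _ → true) ⟧
  ⊤≡⟦true⟧ = lookup-ext λ i → trans (lookup-replicate i inside) (sym (lookup∘tabulate _ i))

  ⟦a⟧─⟦b⟧ : ∀ a b → ⟦ a ⟧ ─ ⟦ b ⟧ ≡ ⟦ (λ t → a t ∧ not (b t)) ⟧
  ⟦a⟧─⟦b⟧ a b = lookup-ext λ i → begin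
    lookup (⟦ a ⟧ ─ ⟦ b ⟧) i
      ≡⟨ lookup-─ ⟦ a ⟧ ⟦ b ⟧ i ⟩
    lookup ⟦ a ⟧ i ∧ not (lookup ⟦ b ⟧ i)
      ≡⟨ cong₂ (λ s t → s ∧ not t) (lookup∘tabulate _ i) (lookup∘tabulate _ i) ⟩
    a (kind i) ∧ not (b (kind i))
      ≡⟨ lookup∘tabulate _ i ⟨
    lookup ⟦ (λ t → a t ∧ not (b t)) ⟧ i ∎
    where open ≡-Reasoning

  lookup-nbhd : ∀ v i → lookup (nbhd graph v) i ≡ not (does (v ≟ i)) ∧ H (kind v) (kind i)
  lookup-nbhd v i = lookup∘tabulate (adj graph v) i

  closedNbhd≡⟦⟧ : ∀ {v} → H (kind v) (kind v) ≡ true → ⁅ v ⁆ ∪ nbhd graph v ≡ ⟦ H (kind v) ⟧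
  closedNbhd≡⟦⟧ {v} Hvv = lookup-ext λ i → begin
    lookup (⁅ v ⁆ ∪ nbhd graph v) i
      ≡⟨ lookup-zipWith _∨_ i ⁅ v ⁆ (nbhd graph v) ⟩
    lookup ⁅ v ⁆ i ∨ lookup (nbhd graph v) i
      ≡⟨ cong₂ _∨_ (lookup-⁅⁆ v i) (lookup-nbhd v i) ⟩
    does (v ≟ i) ∨ (not (does (v ≟ i)) ∧ H (kind v) (kind i))
      ≡⟨ ∨-absorb (v ≟ i) ⟩
    H (kind v) (kind i)
      ≡⟨ lookup∘tabulate _ i ⟨
    lookup ⟦ H (kind v) ⟧ i ∎
    where
    open ≡-Reasoning
    ∨-absorb : ∀ {i} (v≟i : Dec (v ≡ i)) →
               does v≟i ∨ (not (does v≟i) ∧ H (kind v) (kind i)) ≡ H (kind v) (kind i)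
    ∨-absorb (yes refl) = sym Hvv
    ∨-absorb (no _)     = refl

  ⟦a⟧∩nbhd : ∀ a v → ⟦ a ⟧ ∩ nbhd graph v ≡ ⟦ (λ t → a t ∧ H (kind v) t) ⟧ - v
  ⟦a⟧∩nbhd a v = lookup-ext λ i → begin
    lookup (⟦ a ⟧ ∩ nbhd graph v) i
      ≡⟨ lookup-zipWith _∧_ i ⟦ a ⟧ (nbhd graph v) ⟩
    lookup ⟦ a ⟧ i ∧ lookup (nbhd graph v) i
      ≡⟨ cong₂ _∧_ (lookup∘tabulate _ i) (lookup-nbhd v i) ⟩
    a (kind i) ∧ (not (does (v ≟ i)) ∧ H (kind v) (kind i))
      ≡⟨ ∧-rearrange (a (kind i)) (does (v ≟ i)) ⟩
    (a (kind i) ∧ H (kind v) (kind i)) ∧ not (does (v ≟ i))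
      ≡⟨ cong₂ (λ s t → s ∧ not t) (lookup∘tabulate _ i) (lookup-⁅⁆ v i) ⟨
    lookup ⟦ av ⟧ i ∧ not (lookup ⁅ v ⁆ i)
      ≡⟨ lookup-─ ⟦ av ⟧ ⁅ v ⁆ i ⟨
    lookup (⟦ av ⟧ - v) i ∎
    where
    open ≡-Reasoning
    av : T → Bool
    av t = a t ∧ H (kind v) t
    ∧-rearrange : ∀ x y {z} → x ∧ (not y ∧ z) ≡ (x ∧ z) ∧ not y
    ∧-rearrange true  true  = sym (∧-zeroʳ _)
    ∧-rearrange true  false = sym (∧-identityʳ _)
    ∧-rearrange false y     = refl

  suc-degIn≡∣⟦⟧∣ : ∀ a v {t} → kind v ≡ t → a t ∧ H t t ≡ true →
                   suc (degIn graph ⟦ a ⟧ v) ≡ ∣ ⟦ (λ s → a s ∧ H t s) ⟧ ∣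
  suc-degIn≡∣⟦⟧∣ a v refl v∈ =
    trans (cong (suc ∘ ∣_∣) (⟦a⟧∩nbhd a v))
          (x∈p⇒suc∣p-x∣≡∣p∣ (∈⟦⟧⁺ {λ s → a s ∧ H (kind v) s} v∈))

  degIn≡∣⟦⟧∣ : ∀ a v {t} → kind v ≡ t → a t ∧ H t t ≡ false →
               degIn graph ⟦ a ⟧ v ≡ ∣ ⟦ (λ s → a s ∧ H t s) ⟧ ∣
  degIn≡∣⟦⟧∣ a v refl v∉ =
    cong ∣_∣ (trans (⟦a⟧∩nbhd a v) (x∉p⇒p-x≡p (∉⟦⟧⁺ {λ s → a s ∧ H (kind v) s} v∉)))

  greedy-step : ∀ a v {t S} → kind v ≡ t → a t ≡ true → H t t ≡ true →
                (∀ u → u ∈ ⟦ a ⟧ → degIn graph ⟦ a ⟧ v ≤ degIn graph ⟦ a ⟧ u) →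
                GreedyRun graph ⟦ (λ s → a s ∧ not (H t s)) ⟧ S → GreedyRun graph ⟦ a ⟧ (⁅ v ⁆ ∪ S)
  greedy-step a v {S = S} refl av Hvv minimal run =
    step v (∈⟦⟧⁺ {a} av) minimal (subst (λ A → GreedyRun graph A S) (sym remaining) run)
    where
    remaining : ⟦ a ⟧ ─ (⁅ v ⁆ ∪ nbhd graph v) ≡ ⟦ (λ s → a s ∧ not (H (kind v) s)) ⟧
    remaining = trans (cong (⟦ a ⟧ ─_) (closedNbhd≡⟦⟧ Hvv)) (⟦a⟧─⟦b⟧ a (H (kind v)))

  greedy-done : ∀ {a} → (∀ t → a t ≡ false) → GreedyRun graph ⟦ a ⟧ ⊥
  greedy-done {a} a≡false = done λ (v , v∈) → ∉⟦⟧⁺ {a} (a≡false (kind v)) v∈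

  ⟦⟧-clique : ∀ a → (∀ s t → a s ≡ true → a t ≡ true → H s t ≡ true) → IsClique graph ⟦ a ⟧
  ⟦⟧-clique a clique i j i∈ j∈ i≢j =
    trans (adj-≢ i≢j) (clique (kind i) (kind j) (∈⟦⟧⁻ {a} i∈) (∈⟦⟧⁻ {a} j∈))

  ⟦⟧-independent : ∀ a → (∀ s t → a s ≡ true → a t ≡ true → H s t ≡ false) → IsIndependent graph ⟦ a ⟧
  ⟦⟧-independent a indep i j i∈ j∈ =
    trans (cong (not (does (i ≟ j)) ∧_) (indep (kind i) (kind j) (∈⟦⟧⁻ {a} i∈) (∈⟦⟧⁻ {a} j∈))) (∧-zeroʳ _)

  ⟦⟧-nonadjacent : ∀ a v → (∀ t → a t ≡ true → H (kind v) t ≡ false) →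
                   ∀ u → u ∈ ⟦ a ⟧ → adj graph v u ≡ false
  ⟦⟧-nonadjacent a v far u u∈ = trans (cong (not (does (v ≟ u)) ∧_) (far (kind u) (∈⟦⟧⁻ {a} u∈))) (∧-zeroʳ _)

  isInterval : (l r : T → ℕ → ℕ) → (∀ t p → p < n → l t p ≤ r t p) →
               (∀ s t p q → p ≢ q → p < n → q < n →
                  (H s t ≡ true) ⇔ IntervalsIntersect (l s p) (r s p) (l t q) (r t q)) →
               IsIntervalGraph graph
  isInterval l r l≤r rule =
      (λ i → l (kind i) (toℕ i)) , (λ i → r (kind i) (toℕ i))
    , (λ i → l≤r (kind i) (toℕ i) (toℕ<n i))
    , λ i j i≢j → subst (λ b → (b ≡ true) ⇔ _) (sym (adj-≢ i≢j))
                    (rule (kind i) (kind j) (toℕ i) (toℕ j) (i≢j ∘ toℕ-injective) (toℕ<n i) (toℕ<n j))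

twoTrack : ∀ {T : Set} (kind : Fin n → T) (H₁ H₂ : T → T → Bool)
           (H₁-sym : ∀ s t → H₁ s t ≡ H₁ t s) (H₂-sym : ∀ s t → H₂ s t ≡ H₂ t s) →
           IsIntervalGraph (BlowUp.graph kind H₁ H₁-sym) → IsIntervalGraph (BlowUp.graph kind H₂ H₂-sym) →
           Is2TrackIntervalGraph (BlowUp.graph kind (λ s t → H₁ s t ∨ H₂ s t)
                                                     (λ s t → cong₂ _∨_ (H₁-sym s t) (H₂-sym s t)))
twoTrack kind H₁ H₂ H₁-sym H₂-sym interval₁ interval₂ =
  BlowUp.graph kind H₁ H₁-sym , BlowUp.graph kind H₂ H₂-sym , interval₁ , interval₂ ,
  λ i j → ∧-distribˡ-∨ (not (does (i ≟ j))) _ _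

yes⇔ : ∀ {A : Set} → A → (true ≡ true) ⇔ A
yes⇔ a = mk⇔ (λ _ → a) (λ _ → refl)

no⇔ : ∀ {A : Set} → ¬ A → (false ≡ true) ⇔ A
no⇔ ¬a = mk⇔ (λ ()) (λ a → contradiction a ¬a)

module Construction (j : ℕ) where

  m k : ℕ
  m = suc j
  k = suc m

  data Kind : Set where
    apex core centre leaf : Kind

  -- The apex and the centre are single vertices, so making them adjacent to themselves adds no
  -- edge; it makes their closed neighbourhoods unions of kinds (closedNbhd≡⟦⟧).
  edges₁ edges₂ : Kind → Kind → Bool
  edges₁ apex   apex   = true
  edges₁ apex   core   = true
  edges₁ core   core   = true
  edges₁ leaf   core   = true
  edges₁ _      _      = false
  edges₂ centre centre = true
  edges₂ centre leaf   = true
  edges₂ _      _      = false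

  H : Kind → Kind → Bool
  H s t = symmetrise edges₁ s t ∨ symmetrise edges₂ s t

  H-sym : ∀ s t → H s t ≡ H t s
  H-sym s t = cong₂ _∨_ (symmetrise-sym edges₁ s t) (symmetrise-sym edges₂ s t)

  blocks : ∀ {A : Set} → A → A → A → A → Vec A (2 * k)
  blocks a b c d = (a ∷ replicate m b) ++ (c ∷ replicate m d) ++ []

  map-blocks : ∀ {A B : Set} (f : A → B) a b c d → map f (blocks a b c d) ≡ blocks (f a) (f b) (f c) (f d)
  map-blocks f a b c d = begin
    map f ((a ∷ replicate m b) ++ (c ∷ replicate m d) ++ [])
      ≡⟨ map-++ f (a ∷ replicate m b) _ ⟩
    map f (a ∷ replicate m b) ++ map f ((c ∷ replicate m d) ++ [])
      ≡⟨ cong (map f (a ∷ replicate m b) ++_) (map-++ f (c ∷ replicate m d) []) ⟩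
    (f a ∷ map f (replicate m b)) ++ (f c ∷ map f (replicate m d)) ++ []
      ≡⟨ cong₂ (λ p q → (f a ∷ p) ++ (f c ∷ q) ++ []) (map-replicate f b m) (map-replicate f d m) ⟩
    blocks (f a) (f b) (f c) (f d) ∎
    where open ≡-Reasoning

  ∣blocks∣ : ∀ a b c d → ∣ blocks a b c d ∣ ≡ ((if a then 1 else 0) + (if b then m else 0))
                                             + ((if c then 1 else 0) + (if d then m else 0))
  ∣blocks∣ a b c d = trans (∣p++q∣ (a ∷ replicate m b) _) (cong₂ _+_ (∣x∷replicate∣ m a b) ∣second-block∣)
    where
    ∣second-block∣ : ∣ (c ∷ replicate m d) ++ [] ∣ ≡ (if c then 1 else 0) + (if d then m else 0)
    ∣second-block∣ = trans (∣p++q∣ (c ∷ replicate m d) []) (trans (+-identityʳ _) (∣x∷replicate∣ m c d))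

  layout : Vec Kind (2 * k)
  layout = blocks apex core centre leaf

  kind : Fin (2 * k) → Kind
  kind = lookup layout

  open BlowUp kind H H-sym

  ⟦⟧≡blocks : ∀ g → ⟦ g ⟧ ≡ blocks (g apex) (g core) (g centre) (g leaf)
  ⟦⟧≡blocks g = begin
    tabulate (g ∘ lookup layout)      ≡⟨ tabulate-∘ g (lookup layout) ⟩
    map g (tabulate (lookup layout))  ≡⟨ cong (map g) (tabulate∘lookup layout) ⟩
    map g layout                      ≡⟨ map-blocks g apex core centre leaf ⟩
    blocks (g apex) (g core) (g centre) (g leaf) ∎
    where open ≡-Reasoning

  size : (Kind → Bool) → ℕ
  size g = ((if g apex then 1 else 0) + (if g core then m else 0))
         + ((if g centre then 1 else 0) + (if g leaf then m else 0))

  ∣⟦⟧∣ : ∀ g → ∣ ⟦ g ⟧ ∣ ≡ size g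
  ∣⟦⟧∣ g = trans (cong ∣_∣ (⟦⟧≡blocks g)) (∣blocks∣ (g apex) (g core) (g centre) (g leaf))

  G : Graph (2 * k)
  G = graph

  apex₀ core₀ centre₀ leaf₀ : Fin (2 * k)
  apex₀   = zero
  core₀   = suc zero
  centre₀ = k ↑ʳ zero
  leaf₀   = k ↑ʳ suc zero

  kind-centre₀ : kind centre₀ ≡ centre
  kind-centre₀ = lookup-++ʳ (apex ∷ replicate m core) ((centre ∷ replicate m leaf) ++ []) zero

  kind-leaf₀ : kind leaf₀ ≡ leaf
  kind-leaf₀ = lookup-++ʳ (apex ∷ replicate m core) ((centre ∷ replicate m leaf) ++ []) (suc zero)

  all : Kind → Bool
  all _ = true

  deg : Kind → ℕ
  deg apex   = m
  deg core   = m + m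
  deg centre = m
  deg leaf   = suc m

  suc-degIn≡size : ∀ a v {t} → kind v ≡ t → a t ∧ H t t ≡ true →
                   suc (degIn G ⟦ a ⟧ v) ≡ size (λ s → a s ∧ H t s)
  suc-degIn≡size a v {t} v∶t at = trans (suc-degIn≡∣⟦⟧∣ a v v∶t at) (∣⟦⟧∣ (λ s → a s ∧ H t s))

  degIn≡size : ∀ a v {t} → kind v ≡ t → a t ∧ H t t ≡ false →
               degIn G ⟦ a ⟧ v ≡ size (λ s → a s ∧ H t s)
  degIn≡size a v {t} v∶t at = trans (degIn≡∣⟦⟧∣ a v v∶t at) (∣⟦⟧∣ (λ s → a s ∧ H t s))

  degIn-all : ∀ v t → kind v ≡ t → degIn G ⟦ all ⟧ v ≡ deg t
  degIn-all v apex   v∶t = suc-injective (trans (suc-degIn≡size all v v∶t refl) (+-identityʳ (suc m)))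
  degIn-all v core   v∶t = suc-injective (suc-degIn≡size all v v∶t refl)
  degIn-all v centre v∶t = suc-injective (suc-degIn≡size all v v∶t refl)
  degIn-all v leaf   v∶t = trans (degIn≡size all v v∶t refl) (+-comm m 1)

  degree≡deg : ∀ v → degree G v ≡ deg (kind v)
  degree≡deg v = trans (cong (λ A → degIn G A v) ⊤≡⟦true⟧) (degIn-all v (kind v) refl)

  m≤deg : ∀ t → m ≤ deg t
  m≤deg apex   = ≤-refl
  m≤deg core   = m≤m+n m m
  m≤deg centre = ≤-refl
  m≤deg leaf   = n≤1+n m

  deg≤m+m : ∀ t → deg t ≤ m + m
  deg≤m+m apex   = m≤m+n m m
  deg≤m+m core   = ≤-refl
  deg≤m+m centre = m≤m+n m m
  deg≤m+m leaf   = s≤s (m≤n+m m j)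

  2k∸2≡m+m : 2 * k ∸ 2 ≡ m + m
  2k∸2≡m+m = trans (cong (_∸ 1) (+-suc m (m + 0))) (cong (m +_) (+-identityʳ m))

  maxDegree : MaxDegree G (2 * k ∸ 2)
  maxDegree =
      (λ v → subst₂ _≤_ (sym (degree≡deg v)) (sym 2k∸2≡m+m) (deg≤m+m (kind v)))
    , core₀ , trans (degree≡deg core₀) (sym 2k∸2≡m+m)

  clique : Kind → Bool
  clique t = not (H centre t)

  degIn-clique : ∀ v t → kind v ≡ t → clique t ≡ true → degIn G ⟦ clique ⟧ v ≡ m
  degIn-clique v apex v∶t _ = suc-injective (trans (suc-degIn≡size clique v v∶t refl) (+-identityʳ (suc m)))
  degIn-clique v core v∶t _ = suc-injective (trans (suc-degIn≡size clique v v∶t refl) (+-identityʳ (suc m)))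

  greedyRun : GreedyCanReturn G (⁅ centre₀ ⁆ ∪ (⁅ apex₀ ⁆ ∪ ⊥))
  greedyRun = subst (λ A → GreedyRun G A (⁅ centre₀ ⁆ ∪ (⁅ apex₀ ⁆ ∪ ⊥))) (sym ⊤≡⟦true⟧)
    (greedy-step all centre₀ kind-centre₀ refl refl centre-minimal
      (greedy-step clique apex₀ refl refl refl apex-minimal
        (greedy-done {λ s → clique s ∧ not (H apex s)}
          λ { apex → refl ; core → refl ; centre → refl ; leaf → refl })))
    where
    centre-minimal : ∀ u → u ∈ ⟦ all ⟧ → degIn G ⟦ all ⟧ centre₀ ≤ degIn G ⟦ all ⟧ u
    centre-minimal u _ = subst₂ _≤_ (sym (degIn-all centre₀ centre kind-centre₀)) (sym (degIn-all u (kind u) refl))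
                           (m≤deg (kind u))
    apex-minimal : ∀ u → u ∈ ⟦ clique ⟧ → degIn G ⟦ clique ⟧ apex₀ ≤ degIn G ⟦ clique ⟧ u
    apex-minimal u u∈ = ≤-reflexive (trans (degIn-clique apex₀ apex refl refl)
                                           (sym (degIn-clique u (kind u) refl (∈⟦⟧⁻ {clique} u∈))))

  ∣greedySet∣ : ∣ ⁅ centre₀ ⁆ ∪ (⁅ apex₀ ⁆ ∪ ⊥) ∣ ≡ 2
  ∣greedySet∣ = begin
    ∣ ⁅ centre₀ ⁆ ∪ (⁅ apex₀ ⁆ ∪ ⊥) ∣   ≡⟨ x∉p⇒∣⁅x⁆∪p∣≡suc∣p∣ centre₀∉ ⟩
    suc ∣ ⁅ apex₀ ⁆ ∪ ⊥ ∣              ≡⟨ cong suc (x∉p⇒∣⁅x⁆∪p∣≡suc∣p∣ {x = apex₀} ∉⊥) ⟩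
    suc (suc ∣ ⊥ {2 * k} ∣)            ≡⟨ cong (2 +_) (∣⊥∣≡0 (2 * k)) ⟩
    2                                  ∎
    where
    open ≡-Reasoning
    centre₀∉ : centre₀ ∉ ⁅ apex₀ ⁆ ∪ ⊥
    centre₀∉ c∈ with x∈p∪q⁻ ⁅ apex₀ ⁆ ⊥ c∈
    ... | inj₁ c∈apex with trans (sym kind-centre₀) (cong kind (x∈⁅y⁆⇒x≡y apex₀ c∈apex))
    ...   | ()
    centre₀∉ c∈ | inj₂ c∈⊥ = ∉⊥ c∈⊥

  isLeaf : Kind → Bool
  isLeaf leaf = true
  isLeaf _    = false

  leaves-independent : ∀ s t → isLeaf s ≡ true → isLeaf t ≡ true → H s t ≡ false
  leaves-independent leaf   leaf   _  _  = refl
  leaves-independent apex   _      () _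
  leaves-independent core   _      () _
  leaves-independent centre _      () _
  leaves-independent leaf   apex   _  ()
  leaves-independent leaf   core   _  ()
  leaves-independent leaf   centre _  ()

  clique-complete : ∀ s t → clique s ≡ true → clique t ≡ true → H s t ≡ true
  clique-complete apex   apex   _  _  = refl
  clique-complete apex   core   _  _  = refl
  clique-complete core   apex   _  _  = refl
  clique-complete core   core   _  _  = refl
  clique-complete centre _      () _
  clique-complete leaf   _      () _
  clique-complete apex   centre _  ()
  clique-complete apex   leaf   _  ()
  clique-complete core   centre _  ()
  clique-complete core   leaf   _  ()

  leavesAndApex : Subset (2 * k)
  leavesAndApex = ⁅ apex₀ ⁆ ∪ ⟦ isLeaf ⟧

  leavesAndApex-independent : IsIndependent G leavesAndApex
  leavesAndApex-independent = independent-⁅⁆∪ G apex₀ (⟦⟧-independent isLeaf leaves-independent)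
    (⟦⟧-nonadjacent isLeaf apex₀ λ { leaf _ → refl ; apex () ; core () ; centre () })

  ∣leavesAndApex∣ : ∣ leavesAndApex ∣ ≡ k
  ∣leavesAndApex∣ =
    trans (x∉p⇒∣⁅x⁆∪p∣≡suc∣p∣ (∉⟦⟧⁺ {isLeaf} {apex₀} refl)) (cong suc (∣⟦⟧∣ isLeaf))

  independent⇒∣S∣≤k : ∀ S → IsIndependent G S → ∣ S ∣ ≤ k
  independent⇒∣S∣≤k S indS = subst (∣ S ∣ ≤_) (∣⟦⟧∣ (not ∘ clique))
    (independent-bound G indS (⟦⟧-clique clique clique-complete) (p─⟦a⟧⊆⟦not∘a⟧ S clique)
      (∈⟦⟧⁺ {not ∘ clique} {centre₀} (cong (not ∘ clique) kind-centre₀))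
      (∈⟦⟧⁺ {not ∘ clique} {leaf₀} (cong (not ∘ clique) kind-leaf₀))
      (trans (adj-≢ {centre₀} {leaf₀} centre₀≢leaf₀) (cong₂ H kind-centre₀ kind-leaf₀)))
    where
    centre₀≢leaf₀ : centre₀ ≢ leaf₀
    centre₀≢leaf₀ e with trans (sym kind-centre₀) (trans (cong kind e) kind-leaf₀)
    ... | ()

  independenceNumber : IndependenceNumber G k
  independenceNumber = (leavesAndApex , leavesAndApex-independent , ∣leavesAndApex∣) , independent⇒∣S∣≤k

  N : ℕ
  N = 2 * k

  far : ℕ → ℕ
  far p = suc (N + p)

  far≰ : ∀ {a} q → a ≤ N → ¬ far q ≤ a
  far≰ q a≤N far≤a = <⇒≱ (s≤s (m≤m+n N q)) (≤-trans far≤a a≤N)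

  points-apart : ∀ {p q} → p ≢ q → ¬ IntervalsIntersect p p q q
  points-apart p≢q (p≤q , q≤p) = p≢q (≤-antisym p≤q q≤p)

  far-apart : ∀ {p q} → p ≢ q → ¬ IntervalsIntersect (far p) (far p) (far q) (far q)
  far-apart p≢q (p≤q , q≤p) = p≢q (+-cancelˡ-≡ N _ _ (suc-injective (≤-antisym p≤q q≤p)))

  l₁ r₁ l₂ r₂ : Kind → ℕ → ℕ
  l₁ apex   _ = N
  l₁ core   _ = 0
  l₁ centre p = far p
  l₁ leaf   p = p
  r₁ apex   _ = N
  r₁ core   _ = N
  r₁ centre p = far p
  r₁ leaf   p = p
  l₂ centre _ = 0
  l₂ leaf   p = p
  l₂ apex   p = far p
  l₂ core   p = far p
  r₂ centre _ = N
  r₂ leaf   p = p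
  r₂ apex   p = far p
  r₂ core   p = far p

  l₁≤r₁ : ∀ t p → p < N → l₁ t p ≤ r₁ t p
  l₁≤r₁ apex   _ _ = ≤-refl
  l₁≤r₁ core   _ _ = z≤n
  l₁≤r₁ centre _ _ = ≤-refl
  l₁≤r₁ leaf   _ _ = ≤-refl

  l₂≤r₂ : ∀ t p → p < N → l₂ t p ≤ r₂ t p
  l₂≤r₂ centre _ _ = z≤n
  l₂≤r₂ leaf   _ _ = ≤-refl
  l₂≤r₂ apex   _ _ = ≤-refl
  l₂≤r₂ core   _ _ = ≤-refl

  track₁ : ∀ s t p q → p ≢ q → p < N → q < N →
           (symmetrise edges₁ s t ≡ true) ⇔ IntervalsIntersect (l₁ s p) (r₁ s p) (l₁ t q) (r₁ t q)
  track₁ apex   apex   p q _   _   _   = yes⇔ (≤-refl , ≤-refl)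
  track₁ apex   core   p q _   _   _   = yes⇔ (≤-refl , z≤n)
  track₁ apex   centre p q _   _   _   = no⇔ (far≰ q ≤-refl ∘ proj₂)
  track₁ apex   leaf   p q _   _   q<N = no⇔ (<⇒≱ q<N ∘ proj₁)
  track₁ core   apex   p q _   _   _   = yes⇔ (z≤n , ≤-refl)
  track₁ core   core   p q _   _   _   = yes⇔ (z≤n , z≤n)
  track₁ core   centre p q _   _   _   = no⇔ (far≰ q ≤-refl ∘ proj₂)
  track₁ core   leaf   p q _   _   q<N = yes⇔ (z≤n , <⇒≤ q<N)
  track₁ centre apex   p q _   _   _   = no⇔ (far≰ p ≤-refl ∘ proj₁)
  track₁ centre core   p q _   _   _   = no⇔ (far≰ p ≤-refl ∘ proj₁)
  track₁ centre centre p q p≢q _   _   = no⇔ (far-apart p≢q)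
  track₁ centre leaf   p q _   _   q<N = no⇔ (far≰ p (<⇒≤ q<N) ∘ proj₁)
  track₁ leaf   apex   p q _   p<N _   = no⇔ (<⇒≱ p<N ∘ proj₂)
  track₁ leaf   core   p q _   p<N _   = yes⇔ (<⇒≤ p<N , z≤n)
  track₁ leaf   centre p q _   p<N _   = no⇔ (far≰ q (<⇒≤ p<N) ∘ proj₂)
  track₁ leaf   leaf   p q p≢q _   _   = no⇔ (points-apart p≢q)

  track₂ : ∀ s t p q → p ≢ q → p < N → q < N →
           (symmetrise edges₂ s t ≡ true) ⇔ IntervalsIntersect (l₂ s p) (r₂ s p) (l₂ t q) (r₂ t q)
  track₂ centre centre p q _   _   _   = yes⇔ (z≤n , z≤n)
  track₂ centre leaf   p q _   _   q<N = yes⇔ (z≤n , <⇒≤ q<N)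
  track₂ centre apex   p q _   _   _   = no⇔ (far≰ q ≤-refl ∘ proj₂)
  track₂ centre core   p q _   _   _   = no⇔ (far≰ q ≤-refl ∘ proj₂)
  track₂ leaf   centre p q _   p<N _   = yes⇔ (<⇒≤ p<N , z≤n)
  track₂ leaf   leaf   p q p≢q _   _   = no⇔ (points-apart p≢q)
  track₂ leaf   apex   p q _   p<N _   = no⇔ (far≰ q (<⇒≤ p<N) ∘ proj₂)
  track₂ leaf   core   p q _   p<N _   = no⇔ (far≰ q (<⇒≤ p<N) ∘ proj₂)
  track₂ apex   centre p q _   _   _   = no⇔ (far≰ p ≤-refl ∘ proj₁)
  track₂ core   centre p q _   _   _   = no⇔ (far≰ p ≤-refl ∘ proj₁)
  track₂ apex   leaf   p q _   _   q<N = no⇔ (far≰ p (<⇒≤ q<N) ∘ proj₁)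
  track₂ core   leaf   p q _   _   q<N = no⇔ (far≰ p (<⇒≤ q<N) ∘ proj₁)
  track₂ apex   apex   p q p≢q _   _   = no⇔ (far-apart p≢q)
  track₂ apex   core   p q p≢q _   _   = no⇔ (far-apart p≢q)
  track₂ core   apex   p q p≢q _   _   = no⇔ (far-apart p≢q)
  track₂ core   core   p q p≢q _   _   = no⇔ (far-apart p≢q)

  is2Track : Is2TrackIntervalGraph G
  is2Track = twoTrack kind (symmetrise edges₁) (symmetrise edges₂) (symmetrise-sym edges₁) (symmetrise-sym edges₂)
    (BlowUp.isInterval kind (symmetrise edges₁) (symmetrise-sym edges₁) l₁ r₁ l₁≤r₁ track₁)
    (BlowUp.isInterval kind (symmetrise edges₂) (symmetrise-sym edges₂) l₂ r₂ l₂≤r₂ track₂)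

  greedyGap : Σ (Graph (2 * k)) λ G →
                Is2TrackIntervalGraph G ×
                MaxDegree G (2 * k ∸ 2) ×
                (∃ λ S → GreedyCanReturn G S × ∣ S ∣ ≡ 2) ×
                IndependenceNumber G k
  greedyGap = G , is2Track , maxDegree , (_ , greedyRun , ∣greedySet∣) , independenceNumber

lemma7 : ∀ (k : ℕ) → 3 ≤ k →
    Σ (Graph (2 * k)) λ G →
      Is2TrackIntervalGraph G ×
      MaxDegree G (2 * k ∸ 2) ×
      (∃ λ S → GreedyCanReturn G S × ∣ S ∣ ≡ 2) ×
      IndependenceNumber G k
lemma7 (suc zero)    (s≤s ())
lemma7 (suc (suc j)) _ = Construction.greedyGap j
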